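{- Let $V$ be a finite set with $|V|\ge2$ and $T:\ell^2(V)\to\ell^2(V)$ a self-adjoint operator such that $\langle T1_v,1_u\rangle$ is a non-negative integer for all $u,v\in V$ and $\mathrm{vol}_T(\{u\})=d>0$ for all $u$. For $X\subseteq V$ let $\mathcal N(X)=\{v\in V:\langle T1_v,1_X\rangle\ne0\}$. Then for every subset $X\subseteq V$, $$\langle T1_{X\cup\mathcal N(X)},1_{V\setminus(X\cup\mathcal N(X))}\rangle\le\langle T^21_X,1_{V\setminus X}\rangle.$$
   Context: $\ell^2(V)$ is the space of functions $V\to\mathbb C$ with $\langle f,g\rangle=\sum_vf(v)\overline{g(v)}$; $1_F$ denotes the indicator of $F$, $1_v=1_{\{v\}}$; $\mathrm{vol}_T(F)=\langle T1_V,1_F\rangle$. -}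

module Defs where

open import Data.Nat using (ℕ; zero; suc; _+_; _*_)
open import Data.Fin using (Fin; zero; suc)
open import Data.Fin.Subset using (Subset; Side; inside; outside; ⁅_⁆; ⊤; _∪_; ∁)
open import Data.Vec using (lookup; tabulate)
open import Data.Bool using (if_then_else_)
open import Relation.Nullary.Decidable using (does)
open import Data.Nat using (_≟_)

Σ : ∀ {n} → (Fin n → ℕ) → ℕ
Σ {zero}  f = 0
Σ {suc n} f = f zero + Σ (λ i → f (suc i))

-- Functions V → ℕ (the relevant part of ℓ²(V) here: all vectors involved
-- have non-negative integer values).
Fun : ℕ → Set
Fun n = Fin n → ℕ

-- Operator T given by its matrix in the standard basis:
-- Mat T u v = ⟨T 1_v , 1_u⟩ = (T 1_v)(u).
Mat : ℕ → Set
Mat n = Fin n → Fin n → ℕ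

⟨_,_⟩ : ∀ {n} → Fun n → Fun n → ℕ
⟨ f , g ⟩ = Σ (λ v → f v * g v)

app : ∀ {n} → Mat n → Fun n → Fun n
app T f u = Σ (λ v → T u v * f v)

app² : ∀ {n} → Mat n → Fun n → Fun n
app² T f = app T (app T f)

𝟙 : ∀ {n} → Subset n → Fun n
𝟙 F v with lookup F v
... | inside  = 1
... | outside = 0

SelfAdjoint : ∀ {n} → Mat n → Set
SelfAdjoint {n} T = (u v : Fin n) → ⟨ app T (𝟙 ⁅ v ⁆) , 𝟙 ⁅ u ⁆ ⟩ ≡ ⟨ app T (𝟙 ⁅ u ⁆) , 𝟙 ⁅ v ⁆ ⟩
  where open import Relation.Binary.PropositionalEquality using (_≡_)

vol : ∀ {n} → Mat n → Subset n → ℕ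
vol T F = ⟨ app T (𝟙 ⊤) , 𝟙 F ⟩

𝒩 : ∀ {n} → Mat n → Subset n → Subset n
𝒩 T X = tabulate (λ v → if does (⟨ app T (𝟙 ⁅ v ⁆) , 𝟙 X ⟩ ≟ 0) then outside else inside)

-- For u outside Y = X ∪ 𝒩(X) we have u ∉ 𝒩(X), i.e. (T 1_X)(u) = 0 by symmetry of T,
-- so T u v = 0 for every v ∈ X; and every v ∈ 𝒩(X) has (T 1_X)(v) ≥ 1 because the
-- entries are integers. Hence (T 1_Y)(u) ≤ (T² 1_X)(u) for u ∉ Y, and summing over the
-- vertices outside Y, which lie outside X, gives the inequality.
module Submission where

open import Defs
open import Data.Nat using (ℕ; _≤_; _<_)
open import Data.Fin using (Fin)
open import Data.Fin.Subset using (Subset; ⁅_⁆; _∪_; ∁)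
open import Relation.Binary.PropositionalEquality using (_≡_)

open import Data.Nat using (zero; suc; _+_; _*_; z≤n; s≤s; _≟_)
open import Data.Nat.Properties
open import Data.Fin using (zero; suc)
open import Data.Fin.Subset using (⊥; inside; outside; _∈_; _∉_)
open import Data.Fin.Subset.Properties using (_∈?_; x∈p∪q⁺; x∈p∪q⁻; x∈p⇒x∉∁p; x∉p⇒x∈∁p)
open import Data.Bool using (if_then_else_)
open import Data.Sum using (inj₁; inj₂)
open import Function using (_∘_)
open import Data.Vec using (lookup)
open import Data.Vec.Properties using ([]=⇒lookup; lookup⇒[]=; lookup∘tabulate)
open import Relation.Nullary using (yes; no; contradiction)
open import Relation.Nullary.Decidable using (does)
open import Relation.Binary.PropositionalEquality using (refl; sym; trans; cong; cong₂; module ≡-Reasoning)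

private
  variable
    n : ℕ

Σ-cong : (f g : Fun n) → (∀ i → f i ≡ g i) → Σ f ≡ Σ g
Σ-cong {zero}  f g f≡g = refl
Σ-cong {suc n} f g f≡g = cong₂ _+_ (f≡g zero) (Σ-cong (λ i → f (suc i)) (λ i → g (suc i)) (λ i → f≡g (suc i)))

Σ-mono-≤ : (f g : Fun n) → (∀ i → f i ≤ g i) → Σ f ≤ Σ g
Σ-mono-≤ {zero}  f g f≤g = z≤n
Σ-mono-≤ {suc n} f g f≤g = +-mono-≤ (f≤g zero) (Σ-mono-≤ (λ i → f (suc i)) (λ i → g (suc i)) (λ i → f≤g (suc i)))

f≤Σf : (f : Fun n) (i : Fin n) → f i ≤ Σ f
f≤Σf f zero    = m≤m+n (f zero) _
f≤Σf f (suc i) = ≤-trans (f≤Σf (λ j → f (suc j)) i) (m≤n+m _ (f zero))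

Σ-*𝟙⊥ : (f : Fun n) → Σ (λ w → f w * 𝟙 (⊥ {n}) w) ≡ 0
Σ-*𝟙⊥ {zero}  f = refl
Σ-*𝟙⊥ {suc n} f = cong₂ _+_ (*-zeroʳ (f zero)) (Σ-*𝟙⊥ (λ i → f (suc i)))

Σ-*𝟙⁅⁆ : (f : Fun n) (v : Fin n) → Σ (λ w → f w * 𝟙 ⁅ v ⁆ w) ≡ f v
Σ-*𝟙⁅⁆ f zero    = trans (cong₂ _+_ (*-identityʳ (f zero)) (Σ-*𝟙⊥ (λ i → f (suc i)))) (+-identityʳ (f zero))
Σ-*𝟙⁅⁆ f (suc v) = cong₂ _+_ (*-zeroʳ (f zero)) (Σ-*𝟙⁅⁆ (λ i → f (suc i)) v)

app-𝟙⁅⁆ : (T : Mat n) (v u : Fin n) → app T (𝟙 ⁅ v ⁆) u ≡ T u v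
app-𝟙⁅⁆ T v u = Σ-*𝟙⁅⁆ (T u) v

Symmetric : Mat n → Set
Symmetric {n} T = (u v : Fin n) → T u v ≡ T v u

SelfAdjoint⇒Symmetric : (T : Mat n) → SelfAdjoint T → Symmetric T
SelfAdjoint⇒Symmetric T sa u v = begin
  T u v                           ≡⟨ app-𝟙⁅⁆ T v u ⟨
  app T (𝟙 ⁅ v ⁆) u               ≡⟨ Σ-*𝟙⁅⁆ (app T (𝟙 ⁅ v ⁆)) u ⟨
  ⟨ app T (𝟙 ⁅ v ⁆) , 𝟙 ⁅ u ⁆ ⟩   ≡⟨ sa u v ⟩
  ⟨ app T (𝟙 ⁅ u ⁆) , 𝟙 ⁅ v ⁆ ⟩   ≡⟨ Σ-*𝟙⁅⁆ (app T (𝟙 ⁅ u ⁆)) v ⟩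
  app T (𝟙 ⁅ u ⁆) v               ≡⟨ app-𝟙⁅⁆ T u v ⟩
  T v u                           ∎
  where open ≡-Reasoning

⟨app𝟙⁅⁆,𝟙⟩≡app𝟙 : (T : Mat n) → Symmetric T → (X : Subset n) (v : Fin n) →
                  ⟨ app T (𝟙 ⁅ v ⁆) , 𝟙 X ⟩ ≡ app T (𝟙 X) v
⟨app𝟙⁅⁆,𝟙⟩≡app𝟙 T sym-T X v =
  Σ-cong _ _ (λ w → cong (_* 𝟙 X w) (trans (app-𝟙⁅⁆ T v w) (sym-T w v)))

𝟙-∈ : {F : Subset n} {v : Fin n} → v ∈ F → 𝟙 F v ≡ 1
𝟙-∈ v∈F rewrite []=⇒lookup v∈F = refl

𝟙-∉ : {F : Subset n} {v : Fin n} → v ∉ F → 𝟙 F v ≡ 0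
𝟙-∉ {F = F} {v} v∉F with lookup F v in eq
... | inside  = contradiction (lookup⇒[]= v F eq) v∉F
... | outside = refl

𝟙-∪-≤ : (F G : Subset n) (v : Fin n) → 𝟙 (F ∪ G) v ≤ 𝟙 F v + 𝟙 G v
𝟙-∪-≤ F G v with v ∈? F ∪ G
... | no  v∉F∪G rewrite 𝟙-∉ v∉F∪G = z≤n
... | yes v∈F∪G with x∈p∪q⁻ F G v∈F∪G
...   | inj₁ v∈F rewrite 𝟙-∈ v∈F∪G | 𝟙-∈ v∈F = m≤m+n 1 (𝟙 G v)
...   | inj₂ v∈G rewrite 𝟙-∈ v∈F∪G | 𝟙-∈ v∈G = m≤n+m 1 (𝟙 F v)

𝒩-lookup : (T : Mat n) (X : Subset n) (v : Fin n) →
           lookup (𝒩 T X) v ≡ (if does (⟨ app T (𝟙 ⁅ v ⁆) , 𝟙 X ⟩ ≟ 0) then outside else inside)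
𝒩-lookup T X = lookup∘tabulate _

𝟙𝒩≤⟨app𝟙⁅⁆,𝟙⟩ : (T : Mat n) (X : Subset n) (v : Fin n) → 𝟙 (𝒩 T X) v ≤ ⟨ app T (𝟙 ⁅ v ⁆) , 𝟙 X ⟩
𝟙𝒩≤⟨app𝟙⁅⁆,𝟙⟩ T X v rewrite 𝒩-lookup T X v with ⟨ app T (𝟙 ⁅ v ⁆) , 𝟙 X ⟩
... | zero  = z≤n
... | suc _ = s≤s z≤n

∉𝒩⇒⟨app𝟙⁅⁆,𝟙⟩≡0 : (T : Mat n) (X : Subset n) {v : Fin n} → v ∉ 𝒩 T X → ⟨ app T (𝟙 ⁅ v ⁆) , 𝟙 X ⟩ ≡ 0
∉𝒩⇒⟨app𝟙⁅⁆,𝟙⟩≡0 T X {v} v∉𝒩 with ⟨ app T (𝟙 ⁅ v ⁆) , 𝟙 X ⟩ | 𝒩-lookup T X v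
... | zero  | _  = refl
... | suc _ | eq = contradiction (lookup⇒[]= v (𝒩 T X) eq) v∉𝒩

app𝟙[X∪𝒩X]≤app²𝟙X : (T : Mat n) → Symmetric T → (X : Subset n) (u : Fin n) →
                     app T (𝟙 X) u ≡ 0 → app T (𝟙 (X ∪ 𝒩 T X)) u ≤ app² T (𝟙 X) u
app𝟙[X∪𝒩X]≤app²𝟙X T sym-T X u T𝟙X[u]≡0 = Σ-mono-≤ _ _ termwise
  where
    no-edge-into-X : ∀ v → T u v * 𝟙 X v ≡ 0
    no-edge-into-X v = n≤0⇒n≡0 (≤-trans (f≤Σf (λ w → T u w * 𝟙 X w) v) (≤-reflexive T𝟙X[u]≡0))

    𝟙𝒩≤T𝟙X : ∀ v → 𝟙 (𝒩 T X) v ≤ app T (𝟙 X) v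
    𝟙𝒩≤T𝟙X v = ≤-trans (𝟙𝒩≤⟨app𝟙⁅⁆,𝟙⟩ T X v) (≤-reflexive (⟨app𝟙⁅⁆,𝟙⟩≡app𝟙 T sym-T X v))

    termwise : ∀ v → T u v * 𝟙 (X ∪ 𝒩 T X) v ≤ T u v * app T (𝟙 X) v
    termwise v = begin
      T u v * 𝟙 (X ∪ 𝒩 T X) v               ≤⟨ *-monoʳ-≤ (T u v) (𝟙-∪-≤ X (𝒩 T X) v) ⟩
      T u v * (𝟙 X v + 𝟙 (𝒩 T X) v)          ≡⟨ *-distribˡ-+ (T u v) (𝟙 X v) (𝟙 (𝒩 T X) v) ⟩
      T u v * 𝟙 X v + T u v * 𝟙 (𝒩 T X) v    ≡⟨ cong (_+ T u v * 𝟙 (𝒩 T X) v) (no-edge-into-X v) ⟩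
      T u v * 𝟙 (𝒩 T X) v                   ≤⟨ *-monoʳ-≤ (T u v) (𝟙𝒩≤T𝟙X v) ⟩
      T u v * app T (𝟙 X) v                  ∎
      where open ≤-Reasoning

boundary-term-≤ : (T : Mat n) → Symmetric T → (X : Subset n) (u : Fin n) →
                  app T (𝟙 (X ∪ 𝒩 T X)) u * 𝟙 (∁ (X ∪ 𝒩 T X)) u ≤ app² T (𝟙 X) u * 𝟙 (∁ X) u
boundary-term-≤ T sym-T X u with u ∈? X ∪ 𝒩 T X
... | yes u∈Y rewrite 𝟙-∉ (x∈p⇒x∉∁p u∈Y) | *-zeroʳ (app T (𝟙 (X ∪ 𝒩 T X)) u) = z≤n
... | no  u∉Y rewrite 𝟙-∈ (x∉p⇒x∈∁p u∉Y) | 𝟙-∈ (x∉p⇒x∈∁p (u∉Y ∘ x∈p∪q⁺ ∘ inj₁)) =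
  *-monoˡ-≤ 1 (app𝟙[X∪𝒩X]≤app²𝟙X T sym-T X u T𝟙X[u]≡0)
  where
    T𝟙X[u]≡0 : app T (𝟙 X) u ≡ 0
    T𝟙X[u]≡0 = trans (sym (⟨app𝟙⁅⁆,𝟙⟩≡app𝟙 T sym-T X u)) (∉𝒩⇒⟨app𝟙⁅⁆,𝟙⟩≡0 T X (u∉Y ∘ x∈p∪q⁺ ∘ inj₂))

lemma4p3 : (n : ℕ) → 2 ≤ n → (T : Mat n) → SelfAdjoint T →
           (d : ℕ) → 0 < d → ((u : Fin n) → vol T ⁅ u ⁆ ≡ d) →
           (X : Subset n) →
           ⟨ app T (𝟙 (X ∪ 𝒩 T X)) , 𝟙 (∁ (X ∪ 𝒩 T X)) ⟩ ≤ ⟨ app² T (𝟙 X) , 𝟙 (∁ X) ⟩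
lemma4p3 n _ T self-adjoint _ _ _ X =
  Σ-mono-≤ _ _ (boundary-term-≤ T (SelfAdjoint⇒Symmetric T self-adjoint) X)
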